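{- If $(Q,\mathcal{B})$ is a nested SQS$(v)$, then each element of $Q$ is contained in at least $\frac{v-2}{2}$ ND-pairs.
   Context: A Steiner quadruple system SQS$(v)$ is a pair $(Q,\mathcal{B})$ where $Q$ is a set of $v$ points and $\mathcal{B}$ is a collection of 4-subsets of $Q$ (blocks) such that every 3-subset of $Q$ is contained in exactly one block. A nested SQS$(v)$ is an SQS$(v)$ together with a partition of each block into two 2-subsets (pairs). A pair of points is an ND-pair if it is one of the two pairs in the partition of at least one block. -}

module Defs where

open import Data.Nat using (ℕ)
open import Data.Fin using (Fin)
open import Data.Fin.Properties using (_≟_)
open import Data.List using (List; length; filter)
open import Data.List.Relation.Unary.Any using (Any; any?)
open import Data.Product using (_×_; _,_)
open import Data.Sum using (_⊎_)
open import Data.Vec using (allFin)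
open import Data.List using () renaming (_∷_ to _∷ₗ_)
import Data.Vec as V
open import Relation.Binary.PropositionalEquality using (_≡_; _≢_)
open import Relation.Nullary using (Dec; ¬_)
open import Relation.Nullary.Decidable using (_⊎-dec_; _×-dec_)

-- A nested block on the point set Fin v: a 4-subset {a,b,c,d} together with
-- its partition into the two pairs {a,b} and {c,d}.
record NBlock (v : ℕ) : Set where
  constructor nblock
  field
    a b c d : Fin v
open NBlock public

Distinct4 : ∀ {v} → NBlock v → Set
Distinct4 B = (a B ≢ b B) × (a B ≢ c B) × (a B ≢ d B)
            × (b B ≢ c B) × (b B ≢ d B) × (c B ≢ d B)

_∈B_ : ∀ {v} → Fin v → NBlock v → Set
x ∈B B = (x ≡ a B) ⊎ (x ≡ b B) ⊎ (x ≡ c B) ⊎ (x ≡ d B)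

_∈B?_ : ∀ {v} (x : Fin v) (B : NBlock v) → Dec (x ∈B B)
x ∈B? B = (x ≟ a B) ⊎-dec (x ≟ b B) ⊎-dec (x ≟ c B) ⊎-dec (x ≟ d B)

Contains3 : ∀ {v} → NBlock v → Fin v → Fin v → Fin v → Set
Contains3 B x y z = (x ∈B B) × (y ∈B B) × (z ∈B B)

contains3? : ∀ {v} (B : NBlock v) (x y z : Fin v) → Dec (Contains3 B x y z)
contains3? B x y z = (x ∈B? B) ×-dec (y ∈B? B) ×-dec (z ∈B? B)

count3 : ∀ {v} → List (NBlock v) → Fin v → Fin v → Fin v → ℕ
count3 𝓑 x y z = length (filter (λ B → contains3? B x y z) 𝓑)

-- A nested SQS(v) on Q = Fin v: a list of nested blocks, each a 4-subset,
-- such that every 3-subset {x,y,z} of Q lies in exactly one block.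
-- (Exactly one block in the list also rules out repeated blocks.)
IsNestedSQS : (v : ℕ) → List (NBlock v) → Set
IsNestedSQS v 𝓑 =
  (∀ B → Any (B ≡_) 𝓑 → Distinct4 B) ×
  (∀ (x y z : Fin v) → x ≢ y → x ≢ z → y ≢ z → count3 𝓑 x y z ≡ 1)

IsPairOf : ∀ {v} → Fin v → Fin v → NBlock v → Set
IsPairOf x y B = ((x ≡ a B) × (y ≡ b B)) ⊎ ((x ≡ b B) × (y ≡ a B))
               ⊎ ((x ≡ c B) × (y ≡ d B)) ⊎ ((x ≡ d B) × (y ≡ c B))

isPairOf? : ∀ {v} (x y : Fin v) (B : NBlock v) → Dec (IsPairOf x y B)
isPairOf? x y B = ((x ≟ a B) ×-dec (y ≟ b B)) ⊎-dec ((x ≟ b B) ×-dec (y ≟ a B))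
               ⊎-dec ((x ≟ c B) ×-dec (y ≟ d B)) ⊎-dec ((x ≟ d B) ×-dec (y ≟ c B))

IsNDPair : ∀ {v} → List (NBlock v) → Fin v → Fin v → Set
IsNDPair 𝓑 x y = Any (IsPairOf x y) 𝓑

isNDPair? : ∀ {v} (𝓑 : List (NBlock v)) (x y : Fin v) → Dec (IsNDPair 𝓑 x y)
isNDPair? 𝓑 x y = any? (isPairOf? x y) 𝓑

-- number of ND-pairs containing the point x (= number of points y with {x,y} an ND-pair;
-- y ≠ x is automatic since blocks have distinct points)
ndDegree : ∀ {v} → List (NBlock v) → Fin v → ℕ
ndDegree {v} 𝓑 x = length (filter (isNDPair? 𝓑 x) (V.toList (allFin v)))

{-# OPTIONS --safe #-}
module Submission where

open import Defs
open import Data.Nat using (ℕ; _*_; _∸_; _≥_; suc; _+_; _≤_)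
open import Data.Fin using (Fin)
open import Data.List using (List)

open import Data.Bool using (Bool; true; false)
open import Data.Empty using (⊥-elim)
open import Data.Fin.Properties using (_≟_; any?; injective⇒≤)
open import Data.List using ([]; _∷_; map; length; filter; lookup; cartesianProduct)
open import Data.List.Membership.Propositional using (_∈_; lose)
open import Data.List.Membership.Propositional.Properties
  using (∈-filter⁺; ∈-filter⁻; ∈-cartesianProduct⁺)
open import Data.List.Properties using (length-++; length-map)
open import Data.List.Relation.Unary.Any using (here; there; index)
open import Data.List.Relation.Unary.Any.Properties using (lookup-index)
open import Data.Nat.Properties using (≤-trans; ∸-monoˡ-≤; m≤n*m; *-suc)
open import Data.Product using (∃; ∃₂; ∃!; _×_; _,_; proj₁; proj₂; map₂)
open import Data.Sum using (_⊎_; inj₁; inj₂)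
open import Data.Vec using (allFin; toList)
open import Data.Vec.Membership.Propositional.Properties using (∈-allFin⁺; ∈-toList⁺)
open import Function using (_∘_; flip)
open import Function.Definitions using (Injective)
open import Relation.Binary.PropositionalEquality
  using (_≡_; _≢_; refl; sym; trans; cong; cong₂; subst; module ≡-Reasoning)
open import Relation.Nullary using (Dec; yes; no; ¬_; does; ¬?)
open import Relation.Nullary.Decidable using (_⊎-dec_; _×-dec_; decidable-stable; toSum)
open import Relation.Unary using (Decidable)

-- If every other point is an ND-partner of x, the ND-degree of x is v - 1.  Otherwise
-- pick y which is not, and for z ∉ {x, y} let mate z be the partner of x in the block through
-- {x, y, z}.  It is an ND-partner of x different from y, so the block through {x, y, mate z}
-- is that same block, and z is either mate z or the fourth point of it.  Setting
-- mate x = mate y = x, the map z ↦ (z ≟ mate z , mate z) is therefore injective, which gives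
-- v ≤ 2 (ndDegree x + 1).

module _ {A : Set} where

  injective⇒≤length : ∀ {n} {f : Fin n → A} {ys : List A} →
                      Injective _≡_ _≡_ f → (∀ i → f i ∈ ys) → n ≤ length ys
  injective⇒≤length {f = f} {ys} f-inj f∈ys = injective⇒≤ index-inj
    where
    open ≡-Reasoning
    index-inj : Injective _≡_ _≡_ (index ∘ f∈ys)
    index-inj {i} {j} eq = f-inj (begin
      f i                        ≡⟨ lookup-index (f∈ys i) ⟩
      lookup ys (index (f∈ys i)) ≡⟨ cong (lookup ys) eq ⟩
      lookup ys (index (f∈ys j)) ≡⟨ lookup-index (f∈ys j) ⟨
      f j                        ∎)

  filter-length≡1⇒∃! : ∀ {P : A → Set} (P? : Decidable P) (xs : List A) →
                       length (filter P? xs) ≡ 1 → ∃! _≡_ (λ u → u ∈ xs × P u)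
  filter-length≡1⇒∃! P? xs len with filter P? xs in eq
  ... | u ∷ [] = u , ∈-filter⁻ P? (subst (u ∈_) (sym eq) (here refl)) , unique
    where
    unique : ∀ {u'} → u' ∈ xs × _ → u ≡ u'
    unique (u'∈xs , Pu') with subst (_ ∈_) eq (∈-filter⁺ P? u'∈xs Pu')
    ... | here u'≡u = sym u'≡u

  ≡-if-≢-in-pair : ∀ {q r y z z' : A} → y ≡ q ⊎ y ≡ r → z ≡ q ⊎ z ≡ r → z' ≡ q ⊎ z' ≡ r →
                   z ≢ y → z' ≢ y → z ≡ z'
  ≡-if-≢-in-pair _           (inj₁ refl) (inj₁ refl) _   _    = refl
  ≡-if-≢-in-pair _           (inj₂ refl) (inj₂ refl) _   _    = refl
  ≡-if-≢-in-pair (inj₁ refl) (inj₁ refl) (inj₂ _)    z≢y _    = ⊥-elim (z≢y refl)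
  ≡-if-≢-in-pair (inj₂ refl) (inj₁ _)    (inj₂ refl) _   z'≢y = ⊥-elim (z'≢y refl)
  ≡-if-≢-in-pair (inj₁ refl) (inj₂ _)    (inj₁ refl) _   z'≢y = ⊥-elim (z'≢y refl)
  ≡-if-≢-in-pair (inj₂ refl) (inj₂ refl) (inj₁ _)    z≢y _    = ⊥-elim (z≢y refl)

length-cartesianProduct : ∀ {A B : Set} (xs : List A) (ys : List B) →
                          length (cartesianProduct xs ys) ≡ length xs * length ys
length-cartesianProduct []       ys = refl
length-cartesianProduct (x ∷ xs) ys =
  trans (length-++ (map (x ,_) ys))
        (cong₂ _+_ (length-map (x ,_) ys) (length-cartesianProduct xs ys))

module _ {v : ℕ} {B : NBlock v} where

  ∈B⇒∃-IsPairOf : ∀ {x} → x ∈B B → ∃ λ p → IsPairOf x p B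
  ∈B⇒∃-IsPairOf (inj₁ x≡a)               = b B , inj₁ (x≡a , refl)
  ∈B⇒∃-IsPairOf (inj₂ (inj₁ x≡b))        = a B , inj₂ (inj₁ (x≡b , refl))
  ∈B⇒∃-IsPairOf (inj₂ (inj₂ (inj₁ x≡c))) = d B , inj₂ (inj₂ (inj₁ (x≡c , refl)))
  ∈B⇒∃-IsPairOf (inj₂ (inj₂ (inj₂ x≡d))) = c B , inj₂ (inj₂ (inj₂ (x≡d , refl)))

  IsPairOf⇒∈B : ∀ {x p} → IsPairOf x p B → p ∈B B
  IsPairOf⇒∈B (inj₁ (_ , p≡b))               = inj₂ (inj₁ p≡b)
  IsPairOf⇒∈B (inj₂ (inj₁ (_ , p≡a)))        = inj₁ p≡a
  IsPairOf⇒∈B (inj₂ (inj₂ (inj₁ (_ , p≡d)))) = inj₂ (inj₂ (inj₂ p≡d))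
  IsPairOf⇒∈B (inj₂ (inj₂ (inj₂ (_ , p≡c)))) = inj₂ (inj₂ (inj₁ p≡c))

  IsPairOf⇒≢ : ∀ {x p} → Distinct4 B → IsPairOf x p B → x ≢ p
  IsPairOf⇒≢ (a≢b , _) (inj₁ (refl , refl))               = a≢b
  IsPairOf⇒≢ (a≢b , _) (inj₂ (inj₁ (refl , refl)))        = a≢b ∘ sym
  IsPairOf⇒≢ (_ , _ , _ , _ , _ , c≢d) (inj₂ (inj₂ (inj₁ (refl , refl)))) = c≢d
  IsPairOf⇒≢ (_ , _ , _ , _ , _ , c≢d) (inj₂ (inj₂ (inj₂ (refl , refl)))) = c≢d ∘ sym

  outside-ab : ∀ {w} → w ∈B B → w ≢ a B → w ≢ b B → w ≡ c B ⊎ w ≡ d B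
  outside-ab (inj₁ w≡a)         w≢a _   = ⊥-elim (w≢a w≡a)
  outside-ab (inj₂ (inj₁ w≡b))  _   w≢b = ⊥-elim (w≢b w≡b)
  outside-ab (inj₂ (inj₂ w∈cd)) _   _   = w∈cd

  outside-cd : ∀ {w} → w ∈B B → w ≢ c B → w ≢ d B → w ≡ a B ⊎ w ≡ b B
  outside-cd (inj₁ w≡a)               _   _   = inj₁ w≡a
  outside-cd (inj₂ (inj₁ w≡b))        _   _   = inj₂ w≡b
  outside-cd (inj₂ (inj₂ (inj₁ w≡c))) w≢c _   = ⊥-elim (w≢c w≡c)
  outside-cd (inj₂ (inj₂ (inj₂ w≡d))) _   w≢d = ⊥-elim (w≢d w≡d)

  IsPairOf⇒complement : ∀ {x p} → IsPairOf x p B →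
                        ∃₂ λ q r → ∀ {w} → w ∈B B → w ≢ x → w ≢ p → w ≡ q ⊎ w ≡ r
  IsPairOf⇒complement (inj₁ (refl , refl))               = c B , d B , outside-ab
  IsPairOf⇒complement (inj₂ (inj₁ (refl , refl)))        = c B , d B , λ w∈ → flip (outside-ab w∈)
  IsPairOf⇒complement (inj₂ (inj₂ (inj₁ (refl , refl)))) = a B , b B , outside-cd
  IsPairOf⇒complement (inj₂ (inj₂ (inj₂ (refl , refl)))) = a B , b B , λ w∈ → flip (outside-cd w∈)

module _ {v : ℕ} {𝓑 : List (NBlock v)} (sqs : IsNestedSQS v 𝓑) where

  blockThrough : ∀ {x y z} → x ≢ y → x ≢ z → y ≢ z →
                 ∃! _≡_ (λ B → B ∈ 𝓑 × Contains3 B x y z)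
  blockThrough {x} {y} {z} x≢y x≢z y≢z =
    filter-length≡1⇒∃! (λ B → contains3? B x y z) 𝓑 (proj₂ sqs x y z x≢y x≢z y≢z)

  block-unique : ∀ {x y z B B'} → x ≢ y → x ≢ z → y ≢ z →
                 B ∈ 𝓑 → Contains3 B x y z → B' ∈ 𝓑 → Contains3 B' x y z → B ≡ B'
  block-unique x≢y x≢z y≢z B∈𝓑 B∋xyz B'∈𝓑 B'∋xyz =
    trans (sym (unique (B∈𝓑 , B∋xyz))) (unique (B'∈𝓑 , B'∋xyz))
    where unique = proj₂ (proj₂ (blockThrough x≢y x≢z y≢z))

ndPartners : ∀ {v} → List (NBlock v) → Fin v → List (Fin v)
ndPartners {v} 𝓑 x = filter (isNDPair? 𝓑 x) (toList (allFin v))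

IsNDPair⇒∈ndPartners : ∀ {v} {𝓑 : List (NBlock v)} {x y} → IsNDPair 𝓑 x y → y ∈ ndPartners 𝓑 x
IsNDPair⇒∈ndPartners {y = y} = ∈-filter⁺ _ (∈-toList⁺ (∈-allFin⁺ y))

module Mate {v : ℕ} {𝓑 : List (NBlock v)} (sqs : IsNestedSQS v 𝓑)
            {x y : Fin v} (x≢y : x ≢ y) (x≁y : ¬ IsNDPair 𝓑 x y) where

  private
    _∈xy? : ∀ z → Dec (z ≡ x ⊎ z ≡ y)
    z ∈xy? = (z ≟ x) ⊎-dec (z ≟ y)

    -- Splitting on this instead of on z ∈xy? keeps mate z folded in the goal.
    xy-or-not : ∀ z → (z ≡ x ⊎ z ≡ y) ⊎ ¬ (z ≡ x ⊎ z ≡ y)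
    xy-or-not z = toSum (z ∈xy?)

    through : ∀ {z} → ¬ (z ≡ x ⊎ z ≡ y) → ∃ λ B → B ∈ 𝓑 × Contains3 B x y z
    through z∉xy = map₂ proj₁ (blockThrough sqs x≢y (z∉xy ∘ inj₁ ∘ sym) (z∉xy ∘ inj₂ ∘ sym))

  mate : Fin v → Fin v
  mate z with z ∈xy?
  ... | yes _    = x
  ... | no z∉xy = let _ , _ , x∈B , _ = through z∉xy in proj₁ (∈B⇒∃-IsPairOf x∈B)

  mate-xy : ∀ {z} → z ≡ x ⊎ z ≡ y → mate z ≡ x
  mate-xy {z} z∈xy with z ∈xy?
  ... | yes _    = refl
  ... | no z∉xy = ⊥-elim (z∉xy z∈xy)

  mate-spec : ∀ {z} → ¬ (z ≡ x ⊎ z ≡ y) →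
              ∃ λ B → B ∈ 𝓑 × Contains3 B x y z × IsPairOf x (mate z) B
  mate-spec {z} z∉xy with z ∈xy?
  ... | yes z∈xy = ⊥-elim (z∉xy z∈xy)
  ... | no z∉xy′ = let B , B∈𝓑 , B∋xyz = through z∉xy′ in
                   B , B∈𝓑 , B∋xyz , proj₂ (∈B⇒∃-IsPairOf (proj₁ B∋xyz))

  mate-IsNDPair : ∀ {z} → ¬ (z ≡ x ⊎ z ≡ y) → IsNDPair 𝓑 x (mate z)
  mate-IsNDPair z∉xy = let _ , B∈𝓑 , _ , pair = mate-spec z∉xy in lose B∈𝓑 pair

  mate≢x : ∀ {z} → ¬ (z ≡ x ⊎ z ≡ y) → mate z ≢ x
  mate≢x z∉xy = let B , B∈𝓑 , _ , pair = mate-spec z∉xy in IsPairOf⇒≢ (proj₁ sqs B B∈𝓑) pair ∘ sym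

  mate≢y : ∀ z → mate z ≢ y
  mate≢y z with xy-or-not z
  ... | inj₁ z∈xy = x≢y ∘ trans (sym (mate-xy z∈xy))
  ... | inj₂ z∉xy = λ mate≡y → x≁y (subst (IsNDPair 𝓑 x) mate≡y (mate-IsNDPair z∉xy))

  mate∈ : ∀ z → mate z ∈ x ∷ ndPartners 𝓑 x
  mate∈ z with xy-or-not z
  ... | inj₁ z∈xy = here (mate-xy z∈xy)
  ... | inj₂ z∉xy = there (IsNDPair⇒∈ndPartners (mate-IsNDPair z∉xy))

  mate≡x⇒≡y : ∀ {z} → z ≢ x → mate z ≡ x → z ≡ y
  mate≡x⇒≡y {z} z≢x mate≡x with xy-or-not z
  ... | inj₁ (inj₁ z≡x) = ⊥-elim (z≢x z≡x)
  ... | inj₁ (inj₂ z≡y) = z≡y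
  ... | inj₂ z∉xy       = ⊥-elim (mate≢x z∉xy mate≡x)

  mate-injective-off-xy : ∀ {z z'} → ¬ (z ≡ x ⊎ z ≡ y) → ¬ (z' ≡ x ⊎ z' ≡ y) →
                          z ≢ mate z → z' ≢ mate z' → mate z ≡ mate z' → z ≡ z'
  mate-injective-off-xy {z} {z'} z∉xy z'∉xy z≢m z'≢m' m≡m' =
    let B  , B∈𝓑  , (x∈B  , y∈B  , z∈B)   , pair  = mate-spec z∉xy
        B' , B'∈𝓑 , (x∈B' , y∈B' , z'∈B') , pair' = mate-spec z'∉xy
        B≡B' = block-unique sqs x≢y (mate≢x z∉xy ∘ sym) (mate≢y z ∘ sym)
                 B∈𝓑 (x∈B , y∈B , IsPairOf⇒∈B pair)
                 B'∈𝓑 (x∈B' , y∈B' , IsPairOf⇒∈B (subst (λ p → IsPairOf x p B') (sym m≡m') pair'))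
        _ , _ , complement = IsPairOf⇒complement pair
    in ≡-if-≢-in-pair
         (complement y∈B (x≢y ∘ sym) (mate≢y z ∘ sym))
         (complement z∈B (z∉xy ∘ inj₁) z≢m)
         (complement (subst (z' ∈B_) (sym B≡B') z'∈B') (z'∉xy ∘ inj₁) (z'≢m' ∘ flip trans m≡m'))
         (z∉xy ∘ inj₂) (z'∉xy ∘ inj₂)

  mate-injective-off-diagonal : ∀ {z z'} → z ≢ mate z → z' ≢ mate z' → mate z ≡ mate z' → z ≡ z'
  mate-injective-off-diagonal {z} {z'} z≢m z'≢m' m≡m' with mate z ≟ x
  ... | yes m≡x = trans (mate≡x⇒≡y (λ z≡x → z≢m (trans z≡x (sym m≡x))) m≡x)
                        (sym (mate≡x⇒≡y (λ z'≡x → z'≢m' (trans z'≡x (sym m'≡x))) m'≡x))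
    where m'≡x = trans (sym m≡m') m≡x
  ... | no m≢x = mate-injective-off-xy (m≢x ∘ mate-xy) (m≢x ∘ trans m≡m' ∘ mate-xy) z≢m z'≢m' m≡m'

  taggedMate : Fin v → Bool × Fin v
  taggedMate z = does (z ≟ mate z) , mate z

  taggedMate-injective : Injective _≡_ _≡_ taggedMate
  taggedMate-injective {z} {z'} eq = from-tags (cong proj₁ eq) (cong proj₂ eq)
    where
    from-tags : does (z ≟ mate z) ≡ does (z' ≟ mate z') → mate z ≡ mate z' → z ≡ z'
    from-tags _ m≡m' with z ≟ mate z | z' ≟ mate z'
    ... | yes z≡m | yes z'≡m' = trans z≡m (trans m≡m' (sym z'≡m'))
    ... | no z≢m  | no z'≢m'  = mate-injective-off-diagonal z≢m z'≢m' m≡m'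
    from-tags () _ | yes _ | no _
    from-tags () _ | no _  | yes _

  v≤2*suc-ndDegree : v ≤ 2 * suc (ndDegree 𝓑 x)
  v≤2*suc-ndDegree =
    subst (v ≤_) (length-cartesianProduct (true ∷ false ∷ []) (x ∷ ndPartners 𝓑 x))
      (injective⇒≤length taggedMate-injective (λ z → ∈-cartesianProduct⁺ (bool∈ _) (mate∈ z)))
    where
    bool∈ : ∀ t → t ∈ true ∷ false ∷ []
    bool∈ true  = here refl
    bool∈ false = there (here refl)

v≤suc-ndDegree : ∀ {v} {𝓑 : List (NBlock v)} {x} →
                 (∀ y → y ≢ x → IsNDPair 𝓑 x y) → v ≤ suc (ndDegree 𝓑 x)
v≤suc-ndDegree {x = x} all-ND = injective⇒≤length (λ eq → eq) ∈x∷ndPartners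
  where
  ∈x∷ndPartners : ∀ y → y ∈ x ∷ ndPartners _ x
  ∈x∷ndPartners y with y ≟ x
  ... | yes y≡x = here y≡x
  ... | no y≢x  = there (IsNDPair⇒∈ndPartners (all-ND y y≢x))

lemma2p4 : (v : ℕ) (𝓑 : List (NBlock v)) → IsNestedSQS v 𝓑 →
           (x : Fin v) → 2 * ndDegree 𝓑 x ≥ v ∸ 2
lemma2p4 v 𝓑 sqs x = ∸-monoˡ-≤ 2 (subst (v ≤_) (*-suc 2 (ndDegree 𝓑 x)) v≤2*suc-ndDegree)
  where
  v≤2*suc-ndDegree : v ≤ 2 * suc (ndDegree 𝓑 x)
  v≤2*suc-ndDegree with any? (λ y → ¬? (y ≟ x) ×-dec ¬? (isNDPair? 𝓑 x y))
  ... | yes (y , y≢x , x≁y) = Mate.v≤2*suc-ndDegree sqs (y≢x ∘ sym) x≁y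
  ... | no ∄non-partner     = ≤-trans (v≤suc-ndDegree all-ND) (m≤n*m _ 2)
    where
    all-ND : ∀ y → y ≢ x → IsNDPair 𝓑 x y
    all-ND y y≢x = decidable-stable (isNDPair? 𝓑 x y) (λ x≁y → ∄non-partner (y , y≢x , x≁y))
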